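{- Let $n \ge k \ge 2$ be integers with $k$ dividing $n$, and let $M$ be a perfect matching in the complete $k$-uniform hypergraph $K_n^k$ (a set of $n/k$ pairwise disjoint $k$-subsets of the vertex set). Then \[ cc(K_n^k\setminus M) \geq \frac{\log_2\frac{n}{k}}{H(\frac{1}{k})} \geq \frac{k \log_2\frac{n}{k}}{\log_2 (ke)}. \]
   Context: $K_n^k \setminus M$ is the $k$-uniform hypergraph on $n$ vertices whose edges are all $k$-subsets not in $M$. The clique cover number $cc(G)$ of a $k$-uniform hypergraph $G$ is the minimum number of cliques of $G$ (complete $k$-uniform subhypergraphs, i.e. vertex sets all of whose $k$-subsets are edges of $G$) whose union contains every edge of $G$. $H(q) = -q \log_2 q - (1-q) \log_2(1-q)$ is the binary entropy function. -}

module Defs where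

open import Data.Nat using (ℕ; zero; suc; _+_; _*_)
open import Data.Fin using (Fin)
open import Data.Fin.Subset using (Subset; _⊆_; _∩_; ∣_∣; Empty)
open import Data.Product using (∃; _×_)
open import Relation.Binary.PropositionalEquality using (_≡_; _≢_)

record PerfectMatching (n k : ℕ) : Set where
  field
    m        : ℕ
    m*k≡n    : m * k ≡ n
    block    : Fin m → Subset n
    blockSize : ∀ i → ∣ block i ∣ ≡ k
    disjoint : ∀ i j → i ≢ j → Empty (block i ∩ block j)

IsEdge : ∀ {n k} → PerfectMatching n k → Subset n → Set
IsEdge {n} {k} M e = (∣ e ∣ ≡ k) × (∀ i → PerfectMatching.block M i ≢ e)

IsClique : ∀ {n k} → PerfectMatching n k → Subset n → Set
IsClique {n} {k} M C = ∀ (e : Subset n) → e ⊆ C → ∣ e ∣ ≡ k → IsEdge M e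

record CliqueCover {n k : ℕ} (M : PerfectMatching n k) (c : ℕ) : Set where
  field
    clique   : Fin c → Subset n
    isClique : ∀ j → IsClique M (clique j)
    covers   : ∀ (e : Subset n) → IsEdge M e → ∃ λ j → e ⊆ clique j

-- factSum N = Σ_{j=0}^{N} N!/j!   (so factSum N / N! is the N-th partial sum of e)
factSum : ℕ → ℕ
factSum zero    = 1
factSum (suc N) = suc N * factSum N + 1

{-# OPTIONS --safe #-}
-- Write b = k - 1 and let M have m blocks. For a vertex v, call the block of v with v removed its
-- punctured block, and let σ v be the set of cliques containing it. No clique contains a whole
-- block, so a clique lies in σ v for at most one v of each block, whence Σ_v |σ v| ≤ c m. If m ≥ 2,
-- σ is injective: for v ≠ w, replacing v in its block by a vertex u outside it (u = w if possible)
-- gives an edge, and a clique covering it lies in σ v but not in σ w. For distinct subsets x of the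
-- c cliques, Σ_x b ^ (c - |x|) ≤ (1 + b) ^ c, so AM-GM yields n ^ n b ^ (Σ_v (c - |σ v|)) ≤ k ^ (c n).
-- Since Σ_v (c - |σ v|) ≥ c m b and n = m k, an m-th root gives n ^ k b ^ (b c) ≤ k ^ (k c), that
-- is c ≥ log₂ n / H(1/k), which is even stronger than required.
--
-- The second inequality amounts to (1 + 1/a) ^ a ≤ Σ_{j ≤ a} 1/j! for a = k - 1. The polynomial
-- E_r(x) = Σ_{j ≤ r} (r!/j!) a^(r-j) x^j satisfies E_(r+1)(x) + (r+1) E_r(x) ≤ E_(r+1)(x+1), by
-- convexity of x ↦ x^(r+1), and induction on r then gives (1 + a) ^ r r! ≤ E_r(r); at r = a this is
-- the claim.
module Submission where

open import Defs
open import Data.Nat using (ℕ; _+_; _*_; _∸_; _^_; _≤_)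
open import Data.Nat.Divisibility using (_∣_)
open import Data.Nat using (_!)
open import Data.Product using (∃; _×_)

open import Data.Nat using (zero; suc; z≤n; s≤s; s≤s⁻¹; NonZero; >-nonZero; >-nonZero⁻¹; _≤?_)
open import Data.Nat.Properties
open import Data.Nat.Tactic.RingSolver using (solve-∀)
open import Data.List as List using (List; []; _∷_; length)
open import Data.Nat.ListAction using (sum; product)
open import Data.Sum using ([_,_]′; inj₁; inj₂)
open import Function using (_∘_)
open import Data.Empty using (⊥-elim)
open import Data.Product using (_,_; proj₁; proj₂; map₂)
open import Data.Fin using (Fin; zero; suc)
open import Algebra.Properties.CommutativeMonoid.Sum +-0-commutativeMonoid
  using (sum-syntax; ∑-comm; ∑-distrib-+; sum-cong-≗) renaming (sum to ∑)
open import Data.Fin.Properties using () renaming (_≟_ to _≟ᶠ_; suc-injective to suc-injectiveᶠ; 0≢1+n to 0≢1+nᶠ)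
open import Data.Fin.Subset
  using (Subset; Side; inside; outside; _∈_; _∉_; _⊆_; ∣_∣; Nonempty; Empty; ∁; _-_; _∪_; ⁅_⁆)
open import Data.Fin.Subset.Properties
  using (_∈?_; Empty-unique; ∣⊥∣≡0; nonempty?; p⊆q⇒∣p∣≤∣q∣; ∣⁅x⁆∣≡1; x∈⁅y⁆⇒x≡y; p─⊥≡p; ∪-identityʳ;
         ∣p∣≤n; ∣∁p∣≡n∸∣p∣; x∈p∧x≢y⇒x∈p-y; x∈p∩q⁺; x∈p∪q⁺; p─q⊆p; x∈⁅x⁆; _⊆?_)
open import Data.List.Relation.Unary.All using (All; []; _∷_)
open import Data.List.Relation.Unary.Unique.Propositional using (Unique; []; _∷_)
open import Data.List.Relation.Unary.Unique.Propositional.Properties using (tabulate⁺)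
open import Data.List.Properties using (length-tabulate; map-tabulate)
import Data.Bool as Bool
open import Data.Vec using (_∷_; []; here; there; tabulate; lookup)
open import Data.Vec.Properties using (lookup∘tabulate; []=⇒lookup; lookup⇒[]=)
open import Relation.Nullary using (Dec; yes; no; does; contradiction; _×-dec_; ¬_)
open import Relation.Nullary.Decidable using (dec-true)
open import Relation.Unary using (Pred; Decidable)
open import Level using (Level)
open import Relation.Binary.PropositionalEquality

-- Powers and the AM-GM inequality

^-distribʳ-* : ∀ m n o → (m * n) ^ o ≡ m ^ o * n ^ o
^-distribʳ-* m n zero    = refl
^-distribʳ-* m n (suc o) = begin
  m * n * (m * n) ^ o      ≡⟨ cong (m * n *_) (^-distribʳ-* m n o) ⟩
  m * n * (m ^ o * n ^ o)  ≡⟨ interchange m n (m ^ o) (n ^ o) ⟩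
  m * m ^ o * (n * n ^ o)  ∎
  where
  open ≡-Reasoning
  interchange : ∀ a b c d → a * b * (c * d) ≡ a * c * (b * d)
  interchange = solve-∀

^-cancelʳ-≤ : ∀ o .{{_ : NonZero o}} {m n} → m ^ o ≤ n ^ o → m ≤ n
^-cancelʳ-≤ o mᵒ≤nᵒ = ≮⇒≥ (λ n<m → <⇒≱ (^-monoˡ-< o n<m) mᵒ≤nᵒ)

2*m*n≤m*m+n*n : ∀ m n → 2 * m * n ≤ m * m + n * n
2*m*n≤m*m+n*n m n = [ ordered , flipped ]′ (≤-total m n)
  where
  ordered : ∀ {m n} → m ≤ n → 2 * m * n ≤ m * m + n * n
  ordered {m} m≤n with d , refl ← m≤n⇒∃[o]m+o≡n m≤n =
    subst (2 * m * (m + d) ≤_) (square-gap m d) (m≤m+n _ (d * d))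
    where
    square-gap : ∀ m d → 2 * m * (m + d) + d * d ≡ m * m + (m + d) * (m + d)
    square-gap = solve-∀
  flipped : n ≤ m → 2 * m * n ≤ m * m + n * n
  flipped n≤m = subst₂ _≤_ (swap n m) (+-comm (n * n) (m * m)) (ordered n≤m)
    where
    swap : ∀ m n → 2 * m * n ≡ 2 * n * m
    swap = solve-∀

weighted-am-gm : ∀ n a b → suc n * a ^ n * b ≤ n * a ^ suc n + b ^ suc n
weighted-am-gm zero    a b = ≤-reflexive (base a b)
  where
  base : ∀ a b → 1 * 1 * b ≡ 0 * (a * 1) + b * 1
  base = solve-∀
weighted-am-gm (suc n) a b = +-cancelʳ-≤ (n * a ^ suc n * b) _ _ (begin
  suc (suc n) * a ^ suc n * b + n * a ^ suc n * b      ≡⟨ regroup₁ n a b (a ^ n) ⟩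
  suc n * a ^ n * (2 * a * b)                          ≤⟨ *-monoʳ-≤ (suc n * a ^ n) (2*m*n≤m*m+n*n a b) ⟩
  suc n * a ^ n * (a * a + b * b)                      ≡⟨ regroup₂ n a b (a ^ n) ⟩
  suc n * a ^ suc (suc n) + b * (suc n * a ^ n * b)    ≤⟨ +-monoʳ-≤ _ (*-monoʳ-≤ b (weighted-am-gm n a b)) ⟩
  suc n * a ^ suc (suc n) + b * (n * a ^ suc n + b ^ suc n)
    ≡⟨ regroup₃ n a b (a ^ n) (b ^ suc n) ⟩
  suc n * a ^ suc (suc n) + b ^ suc (suc n) + n * a ^ suc n * b ∎)
  where
  open ≤-Reasoning
  regroup₁ : ∀ n a b A → suc (suc n) * (a * A) * b + n * (a * A) * b ≡ suc n * A * (2 * a * b)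
  regroup₁ = solve-∀
  regroup₂ : ∀ n a b A → suc n * A * (a * a + b * b) ≡ suc n * (a * (a * A)) + b * (suc n * A * b)
  regroup₂ = solve-∀
  regroup₃ : ∀ n a b A B → suc n * (a * (a * A)) + b * (n * (a * A) + B)
                          ≡ suc n * (a * (a * A)) + b * B + n * (a * A) * b
  regroup₃ = solve-∀

am-gm-step : ∀ n x s → suc n ^ suc n * x * s ^ n ≤ n ^ n * (x + s) ^ suc n
am-gm-step zero      x s = subst₂ _≤_ (unitsˡ x) (unitsʳ (x + s)) (m≤m+n x s)
  where
  unitsˡ : ∀ x → x ≡ 1 * 1 * x * 1
  unitsˡ = solve-∀
  unitsʳ : ∀ y → y ≡ 1 * (y * 1)
  unitsʳ = solve-∀
am-gm-step n@(suc _) x s = *-cancelˡ-≤ n (+-cancelʳ-≤ (n * a ^ suc n) _ _ (begin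
  n * (suc n ^ suc n * x * s ^ n) + n * a ^ suc n
    ≡⟨ cong (λ t → n * (suc n ^ suc n * x * s ^ n) + n * (a * t)) aⁿ ⟩
  n * (suc n * suc n ^ n * x * s ^ n) + n * (a * (suc n ^ n * s ^ n))
    ≡⟨ expand n x s (suc n ^ n) (s ^ n) ⟩
  suc n * (suc n ^ n * s ^ n) * b   ≡⟨ cong (λ t → suc n * t * b) aⁿ ⟨
  suc n * a ^ n * b                 ≤⟨ weighted-am-gm n a b ⟩
  n * a ^ suc n + b ^ suc n         ≡⟨ +-comm (n * a ^ suc n) (b ^ suc n) ⟩
  b ^ suc n + n * a ^ suc n         ≡⟨ cong (_+ n * a ^ suc n) bⁿ⁺¹ ⟩
  n * (n ^ n * (x + s) ^ suc n) + n * a ^ suc n ∎))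
  where
  open ≤-Reasoning
  a = suc n * s
  b = n * (x + s)
  aⁿ : a ^ n ≡ suc n ^ n * s ^ n
  aⁿ = ^-distribʳ-* (suc n) s n
  bⁿ⁺¹ : b ^ suc n ≡ n * (n ^ n * (x + s) ^ suc n)
  bⁿ⁺¹ = trans (^-distribʳ-* n (x + s) (suc n)) (*-assoc n (n ^ n) _)
  expand : ∀ n x s P S → n * (suc n * P * x * S) + n * (suc n * s * (P * S))
                         ≡ suc n * (P * S) * (n * (x + s))
  expand = solve-∀

n^n≢0 : ∀ n → NonZero (n ^ n)
n^n≢0 zero      = _
n^n≢0 n@(suc _) = m^n≢0 n n

am-gm : ∀ xs → length xs ^ length xs * product xs ≤ sum xs ^ length xs
am-gm []       = ≤-refl
am-gm (x ∷ xs) = *-cancelˡ-≤ (n ^ n) {{n^n≢0 n}} (begin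
  n ^ n * (suc n ^ suc n * (x * product xs))  ≡⟨ regroup (n ^ n) (suc n ^ suc n) x (product xs) ⟩
  suc n ^ suc n * x * (n ^ n * product xs)    ≤⟨ *-monoʳ-≤ (suc n ^ suc n * x) (am-gm xs) ⟩
  suc n ^ suc n * x * sum xs ^ n              ≤⟨ am-gm-step n x (sum xs) ⟩
  n ^ n * (x + sum xs) ^ suc n                ∎)
  where
  open ≤-Reasoning
  n = length xs
  regroup : ∀ N Q x P → N * (Q * (x * P)) ≡ Q * x * (N * P)
  regroup = solve-∀

∑-const : ∀ n x → ∑[ i < n ] x ≡ n * x
∑-const zero    x = refl
∑-const (suc n) x = cong (x +_) (∑-const n x)

∑-mono-≤ : ∀ {n} {f g : Fin n → ℕ} → (∀ i → f i ≤ g i) → ∑ f ≤ ∑ g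
∑-mono-≤ {zero}  f≤g = z≤n
∑-mono-≤ {suc n} f≤g = +-mono-≤ (f≤g zero) (∑-mono-≤ (f≤g ∘ suc))

∑-mono-≤-rigid : ∀ {n} {f g : Fin n → ℕ} → (∀ i → f i ≤ g i) → ∑ g ≤ ∑ f → ∀ i → f i ≡ g i
∑-mono-≤-rigid {suc n} {f} {g} f≤g ∑g≤∑f zero = ≤-antisym (f≤g zero) (+-cancelʳ-≤ (∑ (f ∘ suc)) _ _ (begin
  g zero + ∑ (f ∘ suc)  ≤⟨ +-monoʳ-≤ (g zero) (∑-mono-≤ (f≤g ∘ suc)) ⟩
  ∑ g                   ≤⟨ ∑g≤∑f ⟩
  ∑ f                   ∎))
  where open ≤-Reasoning
∑-mono-≤-rigid {suc n} {f} {g} f≤g ∑g≤∑f (suc i) = ∑-mono-≤-rigid (f≤g ∘ suc) (+-cancelˡ-≤ (f zero) _ _ (begin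
  f zero + ∑ (g ∘ suc)  ≤⟨ +-monoˡ-≤ (∑ (g ∘ suc)) (f≤g zero) ⟩
  ∑ g                   ≤⟨ ∑g≤∑f ⟩
  ∑ f                   ∎)) i
  where open ≤-Reasoning

sum-tabulate : ∀ {n} (f : Fin n → ℕ) → sum (List.tabulate f) ≡ ∑ f
sum-tabulate {zero}  f = refl
sum-tabulate {suc n} f = cong (f zero +_) (sum-tabulate (f ∘ suc))

product-map-^ : ∀ b xs → product (List.map (b ^_) xs) ≡ b ^ sum xs
product-map-^ b []       = refl
product-map-^ b (x ∷ xs) = begin
  b ^ x * product (List.map (b ^_) xs)  ≡⟨ cong (b ^ x *_) (product-map-^ b xs) ⟩
  b ^ x * b ^ sum xs                    ≡⟨ ^-distribˡ-+-* b x (sum xs) ⟨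
  b ^ (x + sum xs)                      ∎
  where open ≡-Reasoning

indicator : Side → ℕ
indicator inside  = 1
indicator outside = 0

∣s∷p∣ : ∀ {n} s (p : Subset n) → ∣ s ∷ p ∣ ≡ indicator s + ∣ p ∣
∣s∷p∣ inside  p = refl
∣s∷p∣ outside p = refl

∣p∣≡∑indicator : ∀ {n} (p : Subset n) → ∣ p ∣ ≡ ∑[ x < n ] indicator (lookup p x)
∣p∣≡∑indicator []      = refl
∣p∣≡∑indicator (s ∷ p) = trans (∣s∷p∣ s p) (cong (indicator s +_) (∣p∣≡∑indicator p))

module _ {ℓ : Level} {n : ℕ} {P : Pred (Fin n) ℓ} where

  select : Decidable P → Subset n
  select P? = tabulate (does ∘ P?)

  ∈-select⁺ : (P? : Decidable P) {x : Fin n} → P x → x ∈ select P?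
  ∈-select⁺ P? {x} px = lookup⇒[]= x _ (trans (lookup∘tabulate _ x) (dec-true (P? x) px))

  ∈-select⁻ : (P? : Decidable P) {x : Fin n} → x ∈ select P? → P x
  ∈-select⁻ P? {x} x∈ with P? x | trans (sym (lookup∘tabulate (does ∘ P?) x)) ([]=⇒lookup x∈)
  ... | yes px | _ = px

  ∣select∣≡∑ : (P? : Decidable P) → ∣ select P? ∣ ≡ ∑[ x < n ] indicator (does (P? x))
  ∣select∣≡∑ P? = trans (∣p∣≡∑indicator (select P?)) (sum-cong-≗ (cong indicator ∘ lookup∘tabulate (does ∘ P?)))

select-∈? : ∀ {n} (p : Subset n) → select (_∈? p) ≡ p
select-∈? []            = refl
select-∈? (inside  ∷ p) = cong (inside ∷_) (select-∈? p)
select-∈? (outside ∷ p) = cong (outside ∷_) (select-∈? p)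

∑-∣select∣-comm : ∀ {ℓ m n} {R : Fin m → Fin n → Set ℓ} (R? : ∀ i x → Dec (R i x)) →
                  ∑[ x < n ] ∣ select (λ i → R? i x) ∣ ≡ ∑[ i < m ] ∣ select (R? i) ∣
∑-∣select∣-comm {m = m} {n} R? = begin
  ∑[ x < n ] ∣ select (λ i → R? i x) ∣               ≡⟨ sum-cong-≗ (λ x → ∣select∣≡∑ (λ i → R? i x)) ⟩
  ∑[ x < n ] ∑[ i < m ] indicator (does (R? i x))   ≡⟨ ∑-comm (λ x i → indicator (does (R? i x))) ⟩
  ∑[ i < m ] ∑[ x < n ] indicator (does (R? i x))   ≡⟨ sum-cong-≗ (λ i → ∣select∣≡∑ (R? i)) ⟨
  ∑[ i < m ] ∣ select (R? i) ∣                      ∎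
  where open ≡-Reasoning

Empty⇒∣p∣≡0 : ∀ {n} {p : Subset n} → Empty p → ∣ p ∣ ≡ 0
Empty⇒∣p∣≡0 {n} empty = trans (cong ∣_∣ (Empty-unique empty)) (∣⊥∣≡0 n)

∣p∣≤1 : ∀ {n} {p : Subset n} → (∀ {x y} → x ∈ p → y ∈ p → x ≡ y) → ∣ p ∣ ≤ 1
∣p∣≤1 {p = []}          _      = z≤n
∣p∣≤1 {p = outside ∷ p} unique = ∣p∣≤1 (λ x∈p y∈p → suc-injectiveᶠ (unique (there x∈p) (there y∈p)))
∣p∣≤1 {p = inside  ∷ p} unique = s≤s (≤-reflexive (Empty⇒∣p∣≡0 empty))
  where
  empty : Empty p
  empty (x , x∈p) = 0≢1+nᶠ (unique here (there x∈p))

x∈p⇒1≤∣p∣ : ∀ {n} {x : Fin n} {p : Subset n} → x ∈ p → 1 ≤ ∣ p ∣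
x∈p⇒1≤∣p∣ {x = x} x∈p = subst (_≤ _) (∣⁅x⁆∣≡1 x) (p⊆q⇒∣p∣≤∣q∣ (λ y∈⁅x⁆ → subst (_∈ _) (sym (x∈⁅y⁆⇒x≡y x y∈⁅x⁆)) x∈p))

1≤∣p∣⇒Nonempty : ∀ {n} {p : Subset n} → 1 ≤ ∣ p ∣ → Nonempty p
1≤∣p∣⇒Nonempty {p = p} 1≤∣p∣ with nonempty? p
... | yes nonempty = nonempty
... | no  empty    = contradiction (Empty⇒∣p∣≡0 empty) (>⇒≢ 1≤∣p∣)

-- Double counting the pairs (x , f x) with x ∈ p.
injectiveOn⇒∣p∣≤ : ∀ {m n} {p : Subset n} (f : Fin n → Fin m) →
                   (∀ {x y} → x ∈ p → y ∈ p → f x ≡ f y → x ≡ y) → ∣ p ∣ ≤ m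
injectiveOn⇒∣p∣≤ {m} {n} {p} f injective = begin
  ∣ p ∣                                          ≡⟨ cong ∣_∣ (select-∈? p) ⟨
  ∣ select (_∈? p) ∣                             ≡⟨ ∣select∣≡∑ (_∈? p) ⟩
  ∑[ x < n ] indicator (does (x ∈? p))           ≤⟨ ∑-mono-≤ hit ⟩
  ∑[ x < n ] ∣ select (λ i → R? i x) ∣           ≡⟨ ∑-∣select∣-comm R? ⟩
  ∑[ i < m ] ∣ select (R? i) ∣                   ≤⟨ ∑-mono-≤ (λ i → ∣p∣≤1 (fibre-unique i)) ⟩
  ∑[ i < m ] 1                                   ≡⟨ trans (∑-const m 1) (*-identityʳ m) ⟩
  m                                              ∎
  where
  open ≤-Reasoning
  R : Fin m → Fin n → Set
  R i x = x ∈ p × f x ≡ i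
  R? : ∀ i x → Dec (R i x)
  R? i x = (x ∈? p) ×-dec (f x ≟ᶠ i)
  hit : ∀ x → indicator (does (x ∈? p)) ≤ ∣ select (λ i → R? i x) ∣
  hit x = hit′ (x ∈? p)
    where
    hit′ : (x∈?p : Dec (x ∈ p)) → indicator (does x∈?p) ≤ ∣ select (λ i → R? i x) ∣
    hit′ (yes x∈p) = x∈p⇒1≤∣p∣ (∈-select⁺ (λ i → R? i x) (x∈p , refl))
    hit′ (no  _)   = z≤n
  fibre-unique : ∀ i {x y} → x ∈ select (R? i) → y ∈ select (R? i) → x ≡ y
  fibre-unique i x∈ y∈ with ∈-select⁻ (R? i) x∈ | ∈-select⁻ (R? i) y∈
  ... | x∈p , fx≡i | y∈p , fy≡i = injective x∈p y∈p (trans fx≡i (sym fy≡i))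

∣p-x∣ : ∀ {n} {x : Fin n} {p : Subset n} → x ∈ p → suc (∣ p - x ∣) ≡ ∣ p ∣
∣p-x∣ {x = zero}  {inside ∷ p} here        = cong (suc ∘ ∣_∣) (p─⊥≡p p)
∣p-x∣ {x = suc x} {s      ∷ p} (there x∈p) = begin
  suc (∣ s ∷ (p - x) ∣)           ≡⟨ cong suc (∣s∷p∣ s (p - x)) ⟩
  suc (indicator s + ∣ p - x ∣)   ≡⟨ +-suc (indicator s) ∣ p - x ∣ ⟨
  indicator s + suc (∣ p - x ∣)   ≡⟨ cong (indicator s +_) (∣p-x∣ x∈p) ⟩
  indicator s + ∣ p ∣             ≡⟨ ∣s∷p∣ s p ⟨
  ∣ s ∷ p ∣                       ∎
  where open ≡-Reasoning

∣p∪⁅x⁆∣ : ∀ {n} {x : Fin n} {p : Subset n} → x ∉ p → ∣ p ∪ ⁅ x ⁆ ∣ ≡ suc (∣ p ∣)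
∣p∪⁅x⁆∣ {x = zero}  {inside  ∷ p} x∉p = contradiction here x∉p
∣p∪⁅x⁆∣ {x = zero}  {outside ∷ p} x∉p = cong (suc ∘ ∣_∣) (∪-identityʳ p)
∣p∪⁅x⁆∣ {x = suc x} {inside  ∷ p} x∉p = cong suc (∣p∪⁅x⁆∣ (x∉p ∘ there))
∣p∪⁅x⁆∣ {x = suc x} {outside ∷ p} x∉p = ∣p∪⁅x⁆∣ (x∉p ∘ there)

∣∁p∣+∣p∣≡n : ∀ {n} (p : Subset n) → ∣ ∁ p ∣ + ∣ p ∣ ≡ n
∣∁p∣+∣p∣≡n p = trans (cong (_+ ∣ p ∣) (∣∁p∣≡n∸∣p∣ p)) (m∸n+n≡m (∣p∣≤n p))

x∈q∧p-x⊆q⇒p⊆q : ∀ {n} {x : Fin n} {p q : Subset n} → x ∈ q → p - x ⊆ q → p ⊆ q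
x∈q∧p-x⊆q⇒p⊆q {x = x} x∈q p-x⊆q {y} y∈p with y ≟ᶠ x
... | yes refl = x∈q
... | no  y≢x  = p-x⊆q (x∈p∧x≢y⇒x∈p-y y∈p y≢x)

p-x⊆q∧p-y⊆q⇒p⊆q : ∀ {n} {x y : Fin n} {p q : Subset n} → x ∈ p → x ≢ y → p - x ⊆ q → p - y ⊆ q → p ⊆ q
p-x⊆q∧p-y⊆q⇒p⊆q x∈p x≢y p-x⊆q p-y⊆q = x∈q∧p-x⊆q⇒p⊆q (p-y⊆q (x∈p∧x≢y⇒x∈p-y x∈p x≢y)) p-x⊆q

-- A Kraft-type inequality

weight : ℕ → ∀ {c} → Subset c → ℕ
weight b x = b ^ ∣ ∁ x ∣

weightSum : ℕ → ∀ {c} → List (Subset c) → ℕ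
weightSum b xs = sum (List.map (weight b) xs)

module _ {c : ℕ} where

  tailsWithHead : Side → List (Subset (suc c)) → List (Subset c)
  tailsWithHead s []             = []
  tailsWithHead s ((t ∷ x) ∷ xs) with t Bool.≟ s
  ... | yes _ = x ∷ tailsWithHead s xs
  ... | no  _ = tailsWithHead s xs

  tailsWithHead-∉ : ∀ s x xs → All (s ∷ x ≢_) xs → All (x ≢_) (tailsWithHead s xs)
  tailsWithHead-∉ s x []             []           = []
  tailsWithHead-∉ s x ((t ∷ y) ∷ xs) (s∷x≢t∷y ∷ ps) with t Bool.≟ s
  ... | yes refl = (s∷x≢t∷y ∘ cong (s ∷_)) ∷ tailsWithHead-∉ s x xs ps
  ... | no  _    = tailsWithHead-∉ s x xs ps

  tailsWithHead-unique : ∀ s xs → Unique xs → Unique (tailsWithHead s xs)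
  tailsWithHead-unique s []             []         = []
  tailsWithHead-unique s ((t ∷ x) ∷ xs) (ps ∷ unique) with t Bool.≟ s
  ... | yes refl = tailsWithHead-∉ t x xs ps ∷ tailsWithHead-unique t xs unique
  ... | no  _    = tailsWithHead-unique s xs unique

  weightSum-split : ∀ b xs →
    weightSum b xs ≡ weightSum b (tailsWithHead inside xs) + b * weightSum b (tailsWithHead outside xs)
  weightSum-split b []                   = sym (*-zeroʳ b)
  weightSum-split b ((inside  ∷ x) ∷ xs) =
    trans (cong (weight b x +_) (weightSum-split b xs)) (sym (+-assoc (weight b x) _ _))
  weightSum-split b ((outside ∷ x) ∷ xs) =
    trans (cong (b * weight b x +_) (weightSum-split b xs)) (regroup b (weight b x) _ _)
    where
    regroup : ∀ b w T F → b * w + (T + b * F) ≡ T + b * (w + F)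
    regroup = solve-∀

-- Over all of Subset c the sum would be exactly (1 + b) ^ c.
weightSum-unique≤ : ∀ b {c} (xs : List (Subset c)) → Unique xs → weightSum b xs ≤ suc b ^ c
weightSum-unique≤ b {zero}  []            _               = z≤n
weightSum-unique≤ b {zero}  ([] ∷ [])     _               = ≤-refl
weightSum-unique≤ b {zero}  ([] ∷ [] ∷ _) ((≢[] ∷ _) ∷ _) = contradiction refl ≢[]
weightSum-unique≤ b {suc c} xs            unique          = begin
  weightSum b xs
    ≡⟨ weightSum-split b xs ⟩
  weightSum b (tailsWithHead inside xs) + b * weightSum b (tailsWithHead outside xs)
    ≤⟨ +-mono-≤ (weightSum-unique≤ b _ (tailsWithHead-unique inside xs unique))
                (*-monoʳ-≤ b (weightSum-unique≤ b _ (tailsWithHead-unique outside xs unique))) ⟩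
  suc b ^ c + b * suc b ^ c ∎
  where open ≤-Reasoning

-- Signatures of vertices

∃-≢ : ∀ {m} → 2 ≤ m → (i : Fin m) → ∃ λ j → j ≢ i
∃-≢ {suc (suc _)} _ zero    = suc zero , λ ()
∃-≢ {suc (suc _)} _ (suc _) = zero , λ ()
∃-≢ {suc zero}    (s≤s ()) zero

module _ {n k : ℕ} (M : PerfectMatching n k) where
  open PerfectMatching M

  block-unique : ∀ {v i j} → v ∈ block i → v ∈ block j → i ≡ j
  block-unique {v} {i} {j} v∈i v∈j with i ≟ᶠ j
  ... | yes i≡j = i≡j
  ... | no  i≢j = contradiction (v , x∈p∩q⁺ (v∈i , v∈j)) (disjoint i j i≢j)

  -- Each vertex lies in at most one block, and the m blocks have n vertices in total.
  ∃-block : ∀ v → ∃ λ i → v ∈ block i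
  ∃-block v = map₂ (∈-select⁻ (∈?-block v)) (1≤∣p∣⇒Nonempty (≤-reflexive (sym (one-block v))))
    where
    ∈?-block : ∀ v i → Dec (v ∈ block i)
    ∈?-block v i = v ∈? block i
    at-most-one : ∀ v → ∣ select (∈?-block v) ∣ ≤ 1
    at-most-one v = ∣p∣≤1 (λ i∈ j∈ → block-unique (∈-select⁻ (∈?-block v) i∈) (∈-select⁻ (∈?-block v) j∈))
    total : ∑[ v < n ] 1 ≤ ∑[ v < n ] ∣ select (∈?-block v) ∣
    total = ≤-reflexive (begin
      ∑[ v < n ] 1                          ≡⟨ trans (∑-const n 1) (*-identityʳ n) ⟩
      n                                     ≡⟨ m*k≡n ⟨
      m * k                                 ≡⟨ ∑-const m k ⟨
      ∑[ i < m ] k                          ≡⟨ sum-cong-≗ (λ i → sym (blockSize i)) ⟩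
      ∑[ i < m ] ∣ block i ∣                ≡⟨ sum-cong-≗ (λ i → cong ∣_∣ (select-∈? (block i))) ⟨
      ∑[ i < m ] ∣ select (_∈? block i) ∣   ≡⟨ ∑-∣select∣-comm (λ i v → ∈?-block v i) ⟨
      ∑[ v < n ] ∣ select (∈?-block v) ∣    ∎)
      where open ≡-Reasoning
    one-block : ∀ v → ∣ select (∈?-block v) ∣ ≡ 1
    one-block = ∑-mono-≤-rigid at-most-one total

  blockOf : Fin n → Fin m
  blockOf v = proj₁ (∃-block v)

  ∈-blockOf : ∀ v → v ∈ block (blockOf v)
  ∈-blockOf v = proj₂ (∃-block v)

  ∃-∉-block : 1 ≤ k → 2 ≤ m → ∀ i → ∃ λ u → u ∉ block i
  ∃-∉-block 1≤k 2≤m i with other , other≢i ← ∃-≢ 2≤m i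
    = map₂ (λ u∈other u∈i → other≢i (block-unique u∈other u∈i))
           (1≤∣p∣⇒Nonempty (subst (1 ≤_) (sym (blockSize other)) 1≤k))

  swap-isEdge : 2 ≤ k → ∀ {i v u} → v ∈ block i → u ∉ block i → IsEdge M ((block i - v) ∪ ⁅ u ⁆)
  swap-isEdge 2≤k {i} {v} {u} v∈B u∉B = size , not-a-block
    where
    B-v⊆B : block i - v ⊆ block i
    B-v⊆B = p─q⊆p (block i) ⁅ v ⁆
    suc∣B-v∣≡k : suc (∣ block i - v ∣) ≡ k
    suc∣B-v∣≡k = trans (∣p-x∣ v∈B) (blockSize i)
    size : ∣ (block i - v) ∪ ⁅ u ⁆ ∣ ≡ k
    size = trans (∣p∪⁅x⁆∣ (u∉B ∘ B-v⊆B)) suc∣B-v∣≡k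
    not-a-block : ∀ j → block j ≢ (block i - v) ∪ ⁅ u ⁆
    not-a-block j B′≡e with x , x∈B-v ← 1≤∣p∣⇒Nonempty (s≤s⁻¹ (subst (2 ≤_) (sym suc∣B-v∣≡k) 2≤k))
      with refl ← block-unique (subst (x ∈_) (sym B′≡e) (x∈p∪q⁺ (inj₁ x∈B-v))) (B-v⊆B x∈B-v)
      = u∉B (subst (u ∈_) (sym B′≡e) (x∈p∪q⁺ (inj₂ (x∈⁅x⁆ u))))

  module _ {c : ℕ} (cover : CliqueCover M c) where
    open CliqueCover cover

    block⊈clique : ∀ i j → ¬ (block i ⊆ clique j)
    block⊈clique i j B⊆C = proj₂ (isClique j (block i) B⊆C (blockSize i)) i refl

    punctured : Fin n → Subset n
    punctured v = block (blockOf v) - v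

    -- Otherwise the whole common block would lie in clique j.
    punctured-unique : ∀ j {v w} → punctured v ⊆ clique j → punctured w ⊆ clique j → blockOf v ≡ blockOf w → v ≡ w
    punctured-unique j {v} {w} Pv⊆C Pw⊆C same with v ≟ᶠ w
    ... | yes v≡w = v≡w
    ... | no  v≢w = ⊥-elim (block⊈clique (blockOf v) j
                      (p-x⊆q∧p-y⊆q⇒p⊆q (∈-blockOf v) v≢w Pv⊆C (subst (λ i → block i - w ⊆ clique j) (sym same) Pw⊆C)))

    ∃-clique⊇punctured∪⁅u⁆ : 2 ≤ k → ∀ v {u} → u ∉ block (blockOf v) → ∃ λ j → punctured v ⊆ clique j × u ∈ clique j
    ∃-clique⊇punctured∪⁅u⁆ 2≤k v {u} u∉B =
      map₂ (λ e⊆C → (λ x∈P → e⊆C (x∈p∪q⁺ (inj₁ x∈P))) , e⊆C (x∈p∪q⁺ (inj₂ (x∈⁅x⁆ u))))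
           (covers (punctured v ∪ ⁅ u ⁆) (swap-isEdge 2≤k (∈-blockOf v) u∉B))

    punctured⊆?clique : ∀ v j → Dec (punctured v ⊆ clique j)
    punctured⊆?clique v j = punctured v ⊆? clique j

    signature : Fin n → Subset c
    signature v = select (punctured⊆?clique v)

    separating-clique : 2 ≤ k → 2 ≤ m → ∀ {v w} → v ≢ w → ∃ λ j → j ∈ signature v × j ∉ signature w
    separating-clique 2≤k 2≤m {v} {w} v≢w = by-cases (w ∈? block (blockOf v))
      where
      by-cases : Dec (w ∈ block (blockOf v)) → ∃ λ j → j ∈ signature v × j ∉ signature w
      by-cases (yes w∈B) =
        let u , u∉B = ∃-∉-block (≤-trans (n≤1+n 1) 2≤k) 2≤m (blockOf v)
            j , Pv⊆C , _ = ∃-clique⊇punctured∪⁅u⁆ 2≤k v u∉B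
        in j , ∈-select⁺ (punctured⊆?clique v) Pv⊆C
             , λ j∈ → v≢w (punctured-unique j Pv⊆C (∈-select⁻ (punctured⊆?clique w) j∈)
                                                 (block-unique w∈B (∈-blockOf w)))
      by-cases (no w∉B) =
        let j , Pv⊆C , w∈C = ∃-clique⊇punctured∪⁅u⁆ 2≤k v w∉B
        in j , ∈-select⁺ (punctured⊆?clique v) Pv⊆C
             , λ j∈ → block⊈clique (blockOf w) j (x∈q∧p-x⊆q⇒p⊆q w∈C (∈-select⁻ (punctured⊆?clique w) j∈))

    signature-injective : 2 ≤ k → 2 ≤ m → ∀ {v w} → signature v ≡ signature w → v ≡ w
    signature-injective 2≤k 2≤m {v} {w} same with v ≟ᶠ w
    ... | yes v≡w = v≡w
    ... | no  v≢w with j , j∈v , j∉w ← separating-clique 2≤k 2≤m v≢w = contradiction (subst (j ∈_) same j∈v) j∉w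

    ∑∣signature∣≤c*m : ∑[ v < n ] ∣ signature v ∣ ≤ c * m
    ∑∣signature∣≤c*m = begin
      ∑[ v < n ] ∣ signature v ∣    ≡⟨ ∑-∣select∣-comm R? ⟩
      ∑[ j < c ] ∣ select (R? j) ∣  ≤⟨ ∑-mono-≤ (λ j → injectiveOn⇒∣p∣≤ blockOf (unique j)) ⟩
      ∑[ j < c ] m                  ≡⟨ ∑-const c m ⟩
      c * m                         ∎
      where
      open ≤-Reasoning
      R? : ∀ j v → Dec (punctured v ⊆ clique j)
      R? j v = punctured⊆?clique v j
      unique : ∀ j {v w} → v ∈ select (R? j) → w ∈ select (R? j) → blockOf v ≡ blockOf w → v ≡ w
      unique j v∈ w∈ = punctured-unique j (∈-select⁻ (R? j) v∈) (∈-select⁻ (R? j) w∈)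

module _ {n b c : ℕ} .{{_ : NonZero b}} {M : PerfectMatching n (suc b)} (cover : CliqueCover M c) where
  open PerfectMatching M using (m; m*k≡n)

  private
    k : ℕ
    k = suc b
    σ : Fin n → Subset c
    σ = signature M cover
    2≤k : 2 ≤ k
    2≤k = s≤s (>-nonZero⁻¹ b)

  c*m*b≤∑∣∁signature∣ : c * m * b ≤ ∑[ v < n ] ∣ ∁ (σ v) ∣
  c*m*b≤∑∣∁signature∣ = +-cancelʳ-≤ (c * m) _ _ (begin
    c * m * b + c * m                         ≡⟨ regroup c m b ⟩
    m * k * c                                 ≡⟨ cong (_* c) m*k≡n ⟩
    n * c                                     ≡⟨ ∑-const n c ⟨
    ∑[ v < n ] c                              ≡⟨ sum-cong-≗ (λ v → ∣∁p∣+∣p∣≡n (σ v)) ⟨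
    ∑[ v < n ] (∣ ∁ (σ v) ∣ + ∣ σ v ∣)        ≡⟨ ∑-distrib-+ (λ v → ∣ ∁ (σ v) ∣) (λ v → ∣ σ v ∣) ⟩
    Z + ∑[ v < n ] ∣ σ v ∣                    ≤⟨ +-monoʳ-≤ Z (∑∣signature∣≤c*m M cover) ⟩
    Z + c * m                                 ∎)
    where
    open ≤-Reasoning
    Z = ∑[ v < n ] ∣ ∁ (σ v) ∣
    regroup : ∀ c m b → c * m * b + c * m ≡ m * suc b * c
    regroup = solve-∀

  n^n*b^∑∣∁signature∣≤[k^c]^n : 2 ≤ m → n ^ n * b ^ (∑[ v < n ] ∣ ∁ (σ v) ∣) ≤ (k ^ c) ^ n
  n^n*b^∑∣∁signature∣≤[k^c]^n 2≤m = begin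
    n ^ n * b ^ (∑[ v < n ] ∣ ∁ (σ v) ∣)
      ≡⟨ cong₂ (λ ℓ p → ℓ ^ ℓ * p) (length-tabulate (weight b ∘ σ)) product-weights ⟨
    length ws ^ length ws * product ws      ≤⟨ am-gm ws ⟩
    sum ws ^ length ws                      ≡⟨ cong (sum ws ^_) (length-tabulate (weight b ∘ σ)) ⟩
    sum ws ^ n                              ≤⟨ ^-monoˡ-≤ n sum-weights ⟩
    (k ^ c) ^ n                             ∎
    where
    open ≤-Reasoning
    ws : List ℕ
    ws = List.tabulate (weight b ∘ σ)
    product-weights : product ws ≡ b ^ (∑[ v < n ] ∣ ∁ (σ v) ∣)
    product-weights = begin-equality
      product ws                                          ≡⟨ cong product (map-tabulate (∣_∣ ∘ ∁ ∘ σ) (b ^_)) ⟨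
      product (List.map (b ^_) (List.tabulate (∣_∣ ∘ ∁ ∘ σ))) ≡⟨ product-map-^ b (List.tabulate (∣_∣ ∘ ∁ ∘ σ)) ⟩
      b ^ sum (List.tabulate (∣_∣ ∘ ∁ ∘ σ))               ≡⟨ cong (b ^_) (sum-tabulate (∣_∣ ∘ ∁ ∘ σ)) ⟩
      b ^ (∑[ v < n ] ∣ ∁ (σ v) ∣)                         ∎
    sum-weights : sum ws ≤ k ^ c
    sum-weights = begin
      sum ws                         ≡⟨ cong sum (map-tabulate σ (weight b)) ⟨
      weightSum b (List.tabulate σ)  ≤⟨ weightSum-unique≤ b _ (tabulate⁺ (signature-injective M cover 2≤k 2≤m)) ⟩
      k ^ c                          ∎

  clique-cover-bound-2≤m : 2 ≤ m → n ^ k * b ^ (b * c) ≤ k ^ (k * c)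
  clique-cover-bound-2≤m 2≤m = ^-cancelʳ-≤ m {{>-nonZero (≤-trans (n≤1+n 1) 2≤m)}} (begin
    (n ^ k * b ^ (b * c)) ^ m          ≡⟨ ^-distribʳ-* (n ^ k) (b ^ (b * c)) m ⟩
    (n ^ k) ^ m * (b ^ (b * c)) ^ m    ≡⟨ cong₂ _*_ nᵏᵐ≡nⁿ bᵇᶜᵐ≡bᶜᵐᵇ ⟩
    n ^ n * b ^ (c * m * b)            ≤⟨ *-monoʳ-≤ (n ^ n) (^-monoʳ-≤ b c*m*b≤∑∣∁signature∣) ⟩
    n ^ n * b ^ (∑[ v < n ] ∣ ∁ (σ v) ∣) ≤⟨ n^n*b^∑∣∁signature∣≤[k^c]^n 2≤m ⟩
    (k ^ c) ^ n                        ≡⟨ kᶜⁿ≡kᵏᶜᵐ ⟩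
    (k ^ (k * c)) ^ m                  ∎)
    where
    open ≤-Reasoning
    k*m≡n : k * m ≡ n
    k*m≡n = trans (*-comm k m) m*k≡n
    nᵏᵐ≡nⁿ : (n ^ k) ^ m ≡ n ^ n
    nᵏᵐ≡nⁿ = trans (^-*-assoc n k m) (cong (n ^_) k*m≡n)
    bᵇᶜᵐ≡bᶜᵐᵇ : (b ^ (b * c)) ^ m ≡ b ^ (c * m * b)
    bᵇᶜᵐ≡bᶜᵐᵇ = trans (^-*-assoc b (b * c) m) (cong (b ^_) (reorder b c m))
      where
      reorder : ∀ b c m → b * c * m ≡ c * m * b
      reorder = solve-∀
    kᶜⁿ≡kᵏᶜᵐ : (k ^ c) ^ n ≡ (k ^ (k * c)) ^ m
    kᶜⁿ≡kᵏᶜᵐ = begin-equality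
      (k ^ c) ^ n          ≡⟨ ^-*-assoc k c n ⟩
      k ^ (c * n)          ≡⟨ cong (λ t → k ^ (c * t)) k*m≡n ⟨
      k ^ (c * (k * m))    ≡⟨ cong (k ^_) (reorder k c m) ⟩
      k ^ (k * c * m)      ≡⟨ ^-*-assoc k (k * c) m ⟨
      (k ^ (k * c)) ^ m    ∎
      where
      reorder : ∀ k c m → c * (k * m) ≡ k * c * m
      reorder = solve-∀

m≤1⇒n≡k : ∀ {m k n} → 1 ≤ k → k ≤ n → m ≤ 1 → m * k ≡ n → n ≡ k
m≤1⇒n≡k {zero}      1≤k k≤n _ refl = contradiction (≤-trans 1≤k k≤n) λ ()
m≤1⇒n≡k {suc zero}  {k} _ _ _ refl = +-identityʳ k
m≤1⇒n≡k {suc (suc _)} _ _ (s≤s ()) _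

-- With a single block, n = k and the hypergraph has no edges; the factor k ^ k covers this case.
clique-cover-bound : ∀ {n b c} .{{_ : NonZero b}} → suc b ≤ n → (M : PerfectMatching n (suc b)) → CliqueCover M c →
                     n ^ suc b * b ^ (b * c) ≤ suc b ^ (suc b * c) * suc b ^ suc b
clique-cover-bound {b = b} {c} k≤n M cover with PerfectMatching.m M ≤? 1
... | no  m≰1 = ≤-trans (clique-cover-bound-2≤m cover (≰⇒> m≰1))
                      (m≤m*n _ (suc b ^ suc b) {{m^n≢0 (suc b) (suc b)}})
... | yes m≤1 = subst (λ n → n ^ suc b * b ^ (b * c) ≤ suc b ^ (suc b * c) * suc b ^ suc b)
                      (sym (m≤1⇒n≡k (s≤s z≤n) k≤n m≤1 (PerfectMatching.m*k≡n M)))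
                      (≤-trans (*-monoʳ-≤ (suc b ^ suc b) bᵇᶜ≤kᵏᶜ)
                               (≤-reflexive (*-comm (suc b ^ suc b) (suc b ^ (suc b * c)))))
  where
  bᵇᶜ≤kᵏᶜ : b ^ (b * c) ≤ suc b ^ (suc b * c)
  bᵇᶜ≤kᵏᶜ = ≤-trans (^-monoˡ-≤ (b * c) (n≤1+n b)) (^-monoʳ-≤ (suc b) (*-monoˡ-≤ c (n≤1+n b)))

-- The truncated exponential

bernoulli : ∀ x n → x ^ suc n + suc n * x ^ n ≤ suc x ^ suc n
bernoulli x zero    = ≤-reflexive (base x)
  where
  base : ∀ x → x * 1 + 1 * 1 ≡ suc x * 1
  base = solve-∀
bernoulli x (suc n) = begin
  x ^ suc (suc n) + suc (suc n) * x ^ suc n          ≤⟨ m≤m+n _ (suc n * x ^ n) ⟩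
  x ^ suc (suc n) + suc (suc n) * x ^ suc n + suc n * x ^ n
    ≡⟨ regroup x n (x ^ n) ⟩
  suc x * (x ^ suc n + suc n * x ^ n)                ≤⟨ *-monoʳ-≤ (suc x) (bernoulli x n) ⟩
  suc x ^ suc (suc n)                                ∎
  where
  open ≤-Reasoning
  regroup : ∀ x n X → x * (x * X) + suc (suc n) * (x * X) + suc n * X ≡ suc x * (x * X + suc n * X)
  regroup = solve-∀

-- truncatedExp a r x = Σ_{j ≤ r} (r!/j!) a^(r-j) x^j, that is r! aʳ Σ_{j ≤ r} (x/a)ʲ/j!.
truncatedExp : ℕ → ℕ → ℕ → ℕ
truncatedExp a zero    x = 1
truncatedExp a (suc r) x = suc r * a * truncatedExp a r x + x ^ suc r

truncatedExp-at-a : ∀ a r → truncatedExp a r a ≡ a ^ r * factSum r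
truncatedExp-at-a a zero    = refl
truncatedExp-at-a a (suc r) = begin
  suc r * a * truncatedExp a r a + a ^ suc r    ≡⟨ cong (λ t → suc r * a * t + a ^ suc r) (truncatedExp-at-a a r) ⟩
  suc r * a * (a ^ r * factSum r) + a * a ^ r   ≡⟨ regroup a r (a ^ r) (factSum r) ⟩
  a * a ^ r * (suc r * factSum r + 1)           ∎
  where
  open ≡-Reasoning
  regroup : ∀ a r A F → suc r * a * (A * F) + a * A ≡ a * A * (suc r * F + 1)
  regroup = solve-∀

-- A discrete form of (d/dx) truncatedExp a (r + 1) = (r + 1) * truncatedExp a r, using convexity.
truncatedExp-step : ∀ a r x → truncatedExp a (suc r) x + suc r * truncatedExp a r x ≤ truncatedExp a (suc r) (suc x)
truncatedExp-step a zero    x = ≤-reflexive (base a x)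
  where
  base : ∀ a x → 1 * a * 1 + x * 1 + 1 * 1 ≡ 1 * a * 1 + suc x * 1
  base = solve-∀
truncatedExp-step a (suc r) x = begin
  E (suc (suc r)) x + suc (suc r) * E (suc r) x
    ≡⟨ regroup a r (E (suc r) x) (E r x) (x ^ suc (suc r)) (x ^ suc r) ⟩
  suc (suc r) * a * (E (suc r) x + suc r * E r x) + (x ^ suc (suc r) + suc (suc r) * x ^ suc r)
    ≤⟨ +-mono-≤ (*-monoʳ-≤ (suc (suc r) * a) (truncatedExp-step a r x)) (bernoulli x (suc r)) ⟩
  E (suc (suc r)) (suc x) ∎
  where
  open ≤-Reasoning
  E = truncatedExp a
  regroup : ∀ a r E₁ E₀ X₂ X₁ → suc (suc r) * a * E₁ + X₂ + suc (suc r) * (suc r * a * E₀ + X₁)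
                              ≡ suc (suc r) * a * (E₁ + suc r * E₀) + (X₂ + suc (suc r) * X₁)
  regroup = solve-∀

[1+a]^r*r!≤truncatedExp : ∀ a r → suc a ^ r * r ! ≤ truncatedExp a r r
[1+a]^r*r!≤truncatedExp a zero    = ≤-refl
[1+a]^r*r!≤truncatedExp a (suc r) = begin
  suc a ^ suc r * suc r !                   ≡⟨ regroup a r (suc a ^ r) (r !) ⟩
  suc r * suc a * (suc a ^ r * r !)         ≤⟨ *-monoʳ-≤ (suc r * suc a) ([1+a]^r*r!≤truncatedExp a r) ⟩
  suc r * suc a * E r r                     ≡⟨ regroup′ a r (E r r) ⟩
  suc r * a * E r r + suc r * E r r         ≤⟨ +-monoˡ-≤ (suc r * E r r) (m≤m+n (suc r * a * E r r) (r ^ suc r)) ⟩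
  E (suc r) r + suc r * E r r               ≤⟨ truncatedExp-step a r r ⟩
  E (suc r) (suc r)                         ∎
  where
  open ≤-Reasoning
  E = truncatedExp a
  regroup : ∀ a r A F → suc a * A * (suc r * F) ≡ suc r * suc a * (A * F)
  regroup = solve-∀
  regroup′ : ∀ a r W → suc r * suc a * W ≡ suc r * a * W + suc r * W
  regroup′ = solve-∀

[1+a]^a*a!≤a^a*factSum : ∀ a → suc a ^ a * a ! ≤ a ^ a * factSum a
[1+a]^a*a!≤a^a*factSum a = ≤-trans ([1+a]^r*r!≤truncatedExp a a) (≤-reflexive (truncatedExp-at-a a a))

corollary1 : ∀ (n k : ℕ) → 2 ≤ k → k ≤ n → k ∣ n → (M : PerfectMatching n k) →
    (∀ (c : ℕ) → CliqueCover M c →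
      n ^ k * (k ∸ 1) ^ ((k ∸ 1) * c) ≤ k ^ (k * c) * k ^ k)
    × (∃ λ (N : ℕ) → k ^ (k ∸ 1) * N ! ≤ (k ∸ 1) ^ (k ∸ 1) * factSum N)
corollary1 n (suc (suc b)) _ k≤n _ M =
  (λ c cover → clique-cover-bound k≤n M cover) , (suc b , [1+a]^a*a!≤a^a*factSum (suc b))
corollary1 n 0             () _   _ _
corollary1 n 1             (s≤s ()) _ _ _
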